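{- Let $(\mathcal{U},\mathcal{F})$ be a Set Cover instance, let $G = f(\mathcal{U},\mathcal{F})$, and let $x \in \mathcal{U}$. If $L$ is an ordering of the vertices of $G_x$ with $\mathrm{wcol}_c(G_x, L) \le t$, then $L(v_S^1) < L(v_S^2)$ for every $S \in \mathcal{F}$ with $x \in S$.
   Context: Graphs are finite and simple. An ordering of a graph $H$ is a bijection $L: V(H) \to \{1,\dots,|V(H)|\}$. For an integer $c$, an ordering $L$ and a vertex $v$, $\mathrm{WReach}_c[H,L,v]$ is the set of vertices $u \neq v$ such that there is a path in $H$ from $v$ to $u$ with at most $c$ edges all of whose vertices $w$ satisfy $L(w) \le L(u)$; $\mathrm{wcol}_c(H,L) = \max_v |\mathrm{WReach}_c[H,L,v]|$, $\mathrm{wcol}_c(H) = \min_L \mathrm{wcol}_c(H,L)$. Construction: a Set Cover instance $(\mathcal{U},\mathcal{F})$ consists of a finite universe $\mathcal{U}$ and a family $\mathcal{F}$ of subsets of $\mathcal{U}$, each element lying in at least one set; $f_x$ is the number of sets containing $x$ and $f_{\max} = \max_x f_x$. Fix an integer $c \ge 3$, let $\ell = \lfloor c/2 \rfloor$, and let $t$ be the smallest integer with $t \ge 4 f_{\max}$ and $t \ge \ell + 3 f_{\max} - 2$. For $S \in \mathcal{F}$, the set gadget $W_S$ consists of disjoint cliques $D_S^1$ on $t$ vertices and $D_S^2$ on $t+1$ vertices, with distinguished vertices $v_S^1 \in D_S^1$, $v_S^2 \in D_S^2$ joined by an edge. For $x \in \mathcal{U}$, the element gadget $G_x$ consists of a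 clique $D_x$ on $t - 3f_x + 2$ vertices and, for each $S \in \mathcal{F}$ with $x \in S$: the set gadget $W_S$, a clique $D_{S,x}$ on $f_x$ vertices, and a path $p_{S,x}^1, \dots, p_{S,x}^\ell$ of $\ell$ new vertices, where $p_{S,x}^1$ is adjacent to every vertex of $D_x$ and of $D_{S,x}$, and $p_{S,x}^\ell$ is adjacent to $v_S^1$. The graph $G = f(\mathcal{U},\mathcal{F})$ is the union of all $G_x$, $x \in \mathcal{U}$, where for each $S$ there is a single copy of $W_S$ shared by all $G_x$ with $x \in S$ (all other parts are disjoint); each $G_x$ is an induced subgraph of $G$. -}

module Defs where

open import Data.Nat using (ℕ; zero; suc; _+_; _*_; _∸_; _⊔_; _≤_; _/_)
open import Data.Fin using (Fin; toℕ) renaming (_<_ to _<ᶠ_; _≤_ to _≤ᶠ_)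
open import Data.Fin.Subset using (Subset; _∈_)
open import Data.Fin.Subset.Properties using (_∈?_)
open import Data.List using (List; []; _∷_; length; filter; map; foldr; allFin)
open import Data.List.Relation.Unary.All using (All)
open import Data.List.Relation.Unary.Unique.Propositional using (Unique)
open import Data.Product using (Σ; ∃; ∃-syntax; _×_)
open import Data.Sum using (_⊎_)
open import Relation.Binary.PropositionalEquality using (_≡_; _≢_)
open import Function.Definitions using (Injective; Bijective)

record Graph : Set₁ where
  field
    V   : Set
    Adj : V → V → Set

module _ (H : Graph) where
  open Graph H

  data Walk : V → V → ℕ → Set where
    here : ∀ {v} → Walk v v 0
    step : ∀ {u w v k} → Adj u w → Walk w v k → Walk u v (suc k)

  verts : ∀ {u v k} → Walk u v k → List V
  verts {u} here = u ∷ []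
  verts {u} (step _ w) = u ∷ verts w

  IsPath : ∀ {u v k} → Walk u v k → Set
  IsPath w = Unique (verts w)

  -- An ordering of H is a bijection L : V(H) → Fin N (N is then |V(H)|;
  -- positions are 0-based, which does not affect any comparison).
  -- u ∈ WReach_c[H,L,v]
  WReach : (c : ℕ) {N : ℕ} (L : V → Fin N) (v u : V) → Set
  WReach c L v u =
    u ≢ v × ∃[ k ] (k ≤ c × Σ (Walk v u k) λ w →
                      IsPath w × All (λ y → L y ≤ᶠ L u) (verts w))

  -- |P| ≤ t for a set P of vertices: every duplicate-free list of
  -- elements of P has length ≤ t
  CardAtMost : (V → Set) → ℕ → Set
  CardAtMost P t = ∀ (xs : List V) → Unique xs → All P xs → length xs ≤ t

  WcolAtMost : (c : ℕ) {N : ℕ} (L : V → Fin N) (t : ℕ) → Set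
  WcolAtMost c L t = ∀ v → CardAtMost (WReach c L v) t

record SetCover : Set where
  field
    n m      : ℕ
    F        : Fin m → Subset n
    distinct : Injective _≡_ _≡_ F
    covers   : ∀ (x : Fin n) → ∃[ i ] (x ∈ F i)

module Construction (c : ℕ) (I : SetCover) where
  open SetCover I

  ℓ : ℕ
  ℓ = c / 2

  freq : Fin n → ℕ
  freq x = length (filter (λ i → x ∈? F i) (allFin m))

  fmax : ℕ
  fmax = foldr _⊔_ 0 (map freq (allFin n))

  t : ℕ
  t = (4 * fmax) ⊔ ((ℓ + 3 * fmax) ∸ 2)

  module Element (x : Fin n) where

    fx : ℕ
    fx = freq x

    SetIdx : Set
    SetIdx = Σ (Fin m) (λ i → x ∈ F i)

    data Vx : Set where
      dx  : Fin ((t + 2) ∸ (3 * fx)) → Vx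
      v1  : SetIdx → Vx
      d1  : SetIdx → Fin (t ∸ 1) → Vx       -- D_S^1 ∖ {v_S^1}  (D_S^1 has t vertices)
      v2  : SetIdx → Vx
      d2  : SetIdx → Fin t → Vx             -- D_S^2 ∖ {v_S^2}  (D_S^2 has t+1 vertices)
      dsx : SetIdx → Fin fx → Vx
      p   : SetIdx → Fin ℓ → Vx             -- p_{S,x}^{j+1}, j : Fin ℓ

    -- one orientation of each edge
    data E : Vx → Vx → Set where
      dx-dx   : ∀ {a b} → a <ᶠ b → E (dx a) (dx b)
      v1-d1   : ∀ {s a} → E (v1 s) (d1 s a)
      d1-d1   : ∀ {s a b} → a <ᶠ b → E (d1 s a) (d1 s b)
      v2-d2   : ∀ {s a} → E (v2 s) (d2 s a)
      d2-d2   : ∀ {s a b} → a <ᶠ b → E (d2 s a) (d2 s b)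
      v1-v2   : ∀ {s} → E (v1 s) (v2 s)
      dsx-dsx : ∀ {s a b} → a <ᶠ b → E (dsx s a) (dsx s b)
      p-p     : ∀ {s j j'} → toℕ j' ≡ suc (toℕ j) → E (p s j) (p s j')
      p-dx    : ∀ {s j a} → toℕ j ≡ 0 → E (p s j) (dx a)
      p-dsx   : ∀ {s j a} → toℕ j ≡ 0 → E (p s j) (dsx s a)
      p-v1    : ∀ {s j} → suc (toℕ j) ≡ ℓ → E (p s j) (v1 s)

    Gx : Graph
    Gx = record { V = Vx ; Adj = λ u v → E u v ⊎ E v u }

module Submission where

-- Suppose L(v_S^2) ≤ L(v_S^1).  The clique D_S^2 has t+1
-- vertices; let m be its L-least vertex.  Every other vertex of D_S^2 is a
-- neighbour of m ranked above it, hence weakly 1-reachable from m; and v_S^1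
-- is weakly 2-reachable from m along m, v_S^2, v_S^1 (or directly, if
-- m = v_S^2), since v_S^1 is ranked above both.  So |WReach_c[G_x,L,m]| ≥ t+1,
-- contradicting wcol_c(G_x,L) ≤ t.

open import Defs
open import Data.Nat using (ℕ; suc; _≤_; _≤?_)
open import Data.Nat.Properties using (≤-refl; ≤-trans; <⇒≤; ≰⇒>; ≮⇒≥; 1+n≰n; ≤-reflexive)
open import Data.Fin using (Fin; toℕ; punchIn; _≟_) renaming (_<_ to _<ᶠ_; _≤_ to _≤ᶠ_)
open import Data.Fin.Properties using (punchInᵢ≢i; punchIn-injective; <-cmp; _<?_)
open import Data.List using (_∷_; tabulate)
open import Data.List.Properties using (length-tabulate)
open import Data.List.Relation.Unary.All using (_∷_; [])
open import Data.List.Relation.Unary.AllPairs using (_∷_; [])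
open import Data.List.Relation.Unary.All.Properties using (tabulate⁺)
open import Data.List.Relation.Unary.Unique.Propositional using (Unique)
import Data.List.Relation.Unary.Unique.Propositional.Properties as Unique
open import Data.Product using (Σ; _,_; proj₁; proj₂)
open import Data.Sum using (inj₁; inj₂)
open import Data.Empty using (⊥-elim)
open import Relation.Binary using (tri<; tri≈; tri>)
open import Relation.Binary.PropositionalEquality using (_≡_; _≢_; refl; sym; cong)
open import Relation.Nullary using (yes; no; ¬_)
open import Function.Definitions using (Bijective)

minimiser : ∀ n (f : Fin (suc n) → ℕ) → Σ (Fin (suc n)) λ i → ∀ j → f i ≤ f j
minimiser 0 f = Fin.zero , λ { Fin.zero → ≤-refl }
minimiser (suc n) f with minimiser n (λ j → f (Fin.suc j))
... | i , i-min with f Fin.zero ≤? f (Fin.suc i)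
...   | yes f0≤ = Fin.zero , λ { Fin.zero → ≤-refl ; (Fin.suc j) → ≤-trans f0≤ (i-min j) }
...   | no f0≰ = Fin.suc i , λ { Fin.zero → <⇒≤ (≰⇒> f0≰) ; (Fin.suc j) → i-min j }

module _ (H : Graph) where
  open Graph H

  record Clique (k : ℕ) : Set where
    field
      member    : Fin k → V
      injective : ∀ {i j} → member i ≡ member j → i ≡ j
      adjacent  : ∀ {i j} → i ≢ j → Adj (member i) (member j)

  module _ {c N : ℕ} (L : V → Fin N) where

    oneEdgeReach : ∀ {u w} → 1 ≤ c → u ≢ w → Adj u w → L u ≤ᶠ L w →
                   WReach H c L u w
    oneEdgeReach 1≤c u≢w uw Lu≤Lw =
      (λ w≡u → u≢w (sym w≡u)) , 1 , 1≤c , step uw here ,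
      ((u≢w ∷ []) ∷ [] ∷ []) , (Lu≤Lw ∷ ≤-refl ∷ [])

    twoEdgeReach : ∀ {u a w} → 2 ≤ c → u ≢ a → u ≢ w → a ≢ w →
                   Adj u a → Adj a w → L u ≤ᶠ L w → L a ≤ᶠ L w →
                   WReach H c L u w
    twoEdgeReach 2≤c u≢a u≢w a≢w ua aw Lu≤Lw La≤Lw =
      (λ w≡u → u≢w (sym w≡u)) , 2 , 2≤c , step ua (step aw here) ,
      ((u≢a ∷ u≢w ∷ []) ∷ (a≢w ∷ []) ∷ [] ∷ []) ,
      (Lu≤Lw ∷ La≤Lw ∷ ≤-refl ∷ [])

    -- A clique on k+1 vertices, together with a vertex u outside it that is
    -- adjacent to a clique member a ranked no higher than u, gives a vertex
    -- (the L-least clique member) with k+1 weakly c-reachable vertices,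
    -- for every c ≥ 2.  Hence wcol_c(H,L) > k.
    cliqueWithUpperNeighbour :
      ∀ {k} (K : Clique (suc k)) → let open Clique K in
      ∀ {u} a → (∀ j → u ≢ member j) → Adj (member a) u →
      L (member a) ≤ᶠ L u → 2 ≤ c → ¬ WcolAtMost H c L k
    cliqueWithUpperNeighbour {k} K {u} a u∉K au La≤Lu 2≤c wcol≤k =
      1+n≰n (≤-trans (≤-reflexive (cong suc (sym (length-tabulate other))))
                     (wcol≤k lowest reached distinct (reachU ∷ tabulate⁺ reachOther)))
      where
      open Clique K
      leastIdx = minimiser k (λ j → toℕ (L (member j)))
      i = proj₁ leastIdx
      lowest = member i
      isLeast : ∀ j → L lowest ≤ᶠ L (member j)
      isLeast = proj₂ leastIdx

      other : Fin k → V
      other j = member (punchIn i j)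

      lowest≢other : ∀ j → lowest ≢ other j
      lowest≢other j eq = punchInᵢ≢i i j (sym (injective eq))

      reached = u ∷ tabulate other

      distinct : Unique reached
      distinct = tabulate⁺ (λ j → u∉K (punchIn i j))
               ∷ Unique.tabulate⁺ (λ eq → punchIn-injective i _ _ (injective eq))

      reachOther : ∀ j → WReach H c L lowest (other j)
      reachOther j = oneEdgeReach (<⇒≤ 2≤c) (lowest≢other j)
                       (adjacent (λ eq → punchInᵢ≢i i j (sym eq))) (isLeast (punchIn i j))

      reachU : WReach H c L lowest u
      reachU with i ≟ a
      ... | yes refl = oneEdgeReach (<⇒≤ 2≤c) (λ eq → u∉K i (sym eq)) au La≤Lu
      ... | no i≢a = twoEdgeReach 2≤c (λ eq → i≢a (injective eq)) (λ eq → u∉K i (sym eq))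
                       (λ eq → u∉K a (sym eq)) (adjacent i≢a) au
                       (≤-trans (isLeast a) La≤Lu) La≤Lu

module _ (c : ℕ) (I : SetCover) (x : Fin (SetCover.n I)) where
  open Construction c I
  open Element x

  D² : SetIdx → Clique Gx (suc t)
  D² s = record { member = member ; injective = injective ; adjacent = adjacent }
    where
    member : Fin (suc t) → Vx
    member Fin.zero    = v2 s
    member (Fin.suc a) = d2 s a

    injective : ∀ {i j} → member i ≡ member j → i ≡ j
    injective {Fin.zero}  {Fin.zero}  _    = refl
    injective {Fin.suc _} {Fin.suc _} refl = refl

    adjacent : ∀ {i j} → i ≢ j → Graph.Adj Gx (member i) (member j)
    adjacent {Fin.zero}  {Fin.zero}  0≢0 = ⊥-elim (0≢0 refl)
    adjacent {Fin.zero}  {Fin.suc _} _   = inj₁ v2-d2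
    adjacent {Fin.suc _} {Fin.zero}  _   = inj₂ v2-d2
    adjacent {Fin.suc a} {Fin.suc b} a≢b with <-cmp a b
    ... | tri< a<b _ _ = inj₁ (d2-d2 a<b)
    ... | tri≈ _ a≡b _ = ⊥-elim (a≢b (cong Fin.suc a≡b))
    ... | tri> _ _ b<a = inj₂ (d2-d2 b<a)

  v1∉D² : ∀ s j → v1 s ≢ Clique.member (D² s) j
  v1∉D² s Fin.zero    ()
  v1∉D² s (Fin.suc _) ()

  v1BeforeV2 : 2 ≤ c → ∀ {N} (L : Vx → Fin N) → WcolAtMost Gx c L t →
               ∀ s → L (v1 s) <ᶠ L (v2 s)
  v1BeforeV2 2≤c L wcol≤t s with L (v1 s) <? L (v2 s)
  ... | yes v1<v2 = v1<v2
  ... | no v1≮v2 =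
    ⊥-elim (cliqueWithUpperNeighbour Gx L (D² s) Fin.zero (v1∉D² s)
              (inj₂ v1-v2) (≮⇒≥ v1≮v2) 2≤c wcol≤t)

-- The argument only needs c ≥ 2 and does not use that L is a bijection.
mainTheorem6 : (c : ℕ) → 3 ≤ c → (I : SetCover) → (x : Fin (SetCover.n I)) →
    let open Construction c I in
    let open Element x in
    (N : ℕ) (L : Vx → Fin N) → Bijective _≡_ _≡_ L →
    WcolAtMost Gx c L t →
    (s : SetIdx) → L (v1 s) <ᶠ L (v2 s)
mainTheorem6 c 3≤c I x N L _ = v1BeforeV2 c I x (<⇒≤ 3≤c) L
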